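{- Let $p$ be a prime and $\alpha\in\mathbb{Z}_p\setminus\{0\}$. Define $\hat F_{\alpha,p}:\mathbb{Z}_p\times\mathbb{Z}_p\to\mathbb{Z}_{p^2}$ by $$\hat F_{\alpha,p}(i,j)=\big((\alpha(j-i) \bmod p)+p(2i-j)\big)\bmod p^2,$$ where elements of $\mathbb{Z}_p$ are identified with integers $0,\dots,p-1$ and $(\alpha(j-i)\bmod p)$ denotes the representative in $\{0,\dots,p-1\}$. Then $\hat F_{\alpha,p}$ is a bijection. -}

module Defs where

open import Data.Nat as ℕ using (ℕ; NonZero)
open import Data.Nat.Properties using (m*n≢0)
open import Data.Integer as ℤ using (ℤ; +_)
open import Data.Integer.DivMod using (_%ℕ_; n%ℕd<d)
open import Data.Fin using (Fin; toℕ; fromℕ<)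
open import Data.Product using (_×_; _,_)

reduce : (m : ℕ) .{{_ : NonZero m}} → ℤ → Fin m
reduce m z = fromℕ< (n%ℕd<d z m)

Fhat : (p : ℕ) .{{_ : NonZero p}} → Fin p → Fin p × Fin p → Fin (p ℕ.* p)
Fhat p α (i , j) =
  reduce (p ℕ.* p) {{m*n≢0 p p}}
    (+ ((ℤ._*_ (+ toℕ α) (ℤ._-_ (+ toℕ j) (+ toℕ i))) %ℕ p)
     ℤ.+ (+ p) ℤ.* (ℤ._-_ ((+ 2) ℤ.* (+ toℕ i)) (+ toℕ j)))

-- Write F̂(i, j) = r + p(2i − j) mod p², where r = α(j − i) mod p lies in [0, p).
-- If two values agree mod p², reducing mod p shows their r's agree; the remaining
-- difference p(2i − j) − p(2i′ − j′) is then divisible by p², so 2i − j ≡ 2i′ − j′ (mod p).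
-- Equal r's give α(j − i) ≡ α(j′ − i′), hence j − i ≡ j′ − i′ as p is prime and p ∤ α.
-- Since (i, j) ↦ (2i − j, j − i) is invertible over ℤ, (i, j) = (i′, j′).  An injective
-- self-map of a set with p² elements is onto.

module Submission where

open import Defs
open import Data.Nat using (ℕ; NonZero)
open import Data.Nat.Primality using (Prime)
open import Data.Fin using (Fin; toℕ; punchOut)
open import Data.Product using (_×_; _,_)
open import Relation.Binary.PropositionalEquality
  using (_≡_; _≢_; refl; sym; cong; cong₂; subst; subst₂; module ≡-Reasoning)
open import Relation.Nullary using (¬_; yes; no; contradiction)
open import Function.Definitions using (Bijective)

import Data.Nat as ℕ
import Data.Nat.Properties as ℕ
import Data.Nat.Divisibility as ℕ
open import Data.Nat.Coprimality using (prime⇒coprime)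
open import Data.Integer using (ℤ; +_; _+_; _-_; _*_; ∣_∣)
import Data.Integer.Properties as ℤ
open import Data.Integer.DivMod using (_%ℕ_; _/ℕ_; n%ℕd<d; a≡a%ℕn+[a/ℕn]*n)
open import Data.Integer.Divisibility.Signed
  using ( _∣_; divides; ∣⇒∣ᵤ; ∣ᵤ⇒∣; ∣-refl; ∣-trans
        ; ∣m∣n⇒∣m+n; ∣m∣n⇒∣m-n; ∣m+n∣n⇒∣m; ∣m⇒∣m*n; *-cancelˡ-∣)
open import Data.Integer.Coprimality using (coprime-divisor)
open import Data.Integer.Tactic.RingSolver using (solve-∀)
import Data.Fin.Properties as Fin
open import Function using (_∘_; _↔_; Inverse; Injection; Injective; Surjective)
open import Function.Properties.Inverse using (↔⇒↣)

n∣n*n : ∀ n → + n ∣ + (n ℕ.* n)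
n∣n*n n = divides (+ n) (ℤ.pos-* n n)

m∣x-x%ℕm : ∀ x m .{{_ : NonZero m}} → + m ∣ x - + (x %ℕ m)
m∣x-x%ℕm x m = divides (x /ℕ m) (begin
  x - + (x %ℕ m)                                ≡⟨ cong (_- + (x %ℕ m)) (a≡a%ℕn+[a/ℕn]*n x m) ⟩
  (+ (x %ℕ m) + x /ℕ m * + m) - + (x %ℕ m)      ≡⟨ [a+b]-a≡b (+ (x %ℕ m)) (x /ℕ m * + m) ⟩
  x /ℕ m * + m                                  ∎)
  where
  open ≡-Reasoning
  [a+b]-a≡b : ∀ a b → (a + b) - a ≡ b
  [a+b]-a≡b = solve-∀

%ℕ≡⇒∣ : ∀ m .{{_ : NonZero m}} x y → x %ℕ m ≡ y %ℕ m → + m ∣ x - y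
%ℕ≡⇒∣ m x y eq = subst (+ m ∣_) (x-r-[y-r]≡x-y x y (+ (x %ℕ m)))
  (∣m∣n⇒∣m-n (m∣x-x%ℕm x m) (subst (λ r → + m ∣ y - + r) (sym eq) (m∣x-x%ℕm y m)))
  where
  x-r-[y-r]≡x-y : ∀ x y r → (x - r) - (y - r) ≡ x - y
  x-r-[y-r]≡x-y = solve-∀

reduce≡⇒∣ : ∀ m .{{_ : NonZero m}} x y → reduce m x ≡ reduce m y → + m ∣ x - y
reduce≡⇒∣ m x y eq = %ℕ≡⇒∣ m x y (begin
  x %ℕ m                 ≡⟨ Fin.toℕ-fromℕ< _ ⟨
  toℕ (reduce m x)       ≡⟨ cong toℕ eq ⟩
  toℕ (reduce m y)       ≡⟨ Fin.toℕ-fromℕ< _ ⟩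
  y %ℕ m                 ∎)
  where open ≡-Reasoning

∣-<⇒≡ : ∀ {m a b} → a ℕ.< m → b ℕ.< m → + m ∣ + a - + b → a ≡ b
∣-<⇒≡ {m} {a} {b} a<m b<m m∣a-b = ℤ.+-injective (ℤ.i-j≡0⇒i≡j (+ a) (+ b) (ℤ.∣i∣≡0⇒i≡0 ∣a-b∣≡0))
  where
  ∣a-b∣<m : ∣ + a - + b ∣ ℕ.< m
  ∣a-b∣<m = ℕ.≤-<-trans
    (subst (ℕ._≤ a ℕ.⊔ b) (cong ∣_∣ (sym (ℤ.[+m]-[+n]≡m⊖n a b))) (ℤ.∣m⊝n∣≤m⊔n a b))
    (ℕ.⊔-pres-<m a<m b<m)
  ∣a-b∣≡0 : ∣ + a - + b ∣ ≡ 0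
  ∣a-b∣≡0 with ∣ + a - + b ∣ in eq
  ... | 0       = refl
  ... | ℕ.suc _ = contradiction (subst (m ℕ.∣_) eq (∣⇒∣ᵤ m∣a-b)) (ℕ.>⇒∤ (subst (ℕ._< m) eq ∣a-b∣<m))

Fin-∣⇒≡ : ∀ {n} {i j : Fin n} → + n ∣ + toℕ i - + toℕ j → i ≡ j
Fin-∣⇒≡ {i = i} {j} n∣i-j = Fin.toℕ-injective (∣-<⇒≡ (Fin.toℕ<n i) (Fin.toℕ<n j) n∣i-j)

prime∣n*i⇒∣i : ∀ {p n i} → Prime p → .{{_ : NonZero n}} → n ℕ.< p → + p ∣ + n * i → + p ∣ i
prime∣n*i⇒∣i {p} {n} {i} p-prime n<p p∣n*i =
  ∣ᵤ⇒∣ (coprime-divisor (+ p) (+ n) i (prime⇒coprime p-prime n<p) (∣⇒∣ᵤ p∣n*i))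

∣[a+m*b]-[c+m*d]⇒∣a-c : ∀ m a b c d → + m ∣ (a + + m * b) - (c + + m * d) → + m ∣ a - c
∣[a+m*b]-[c+m*d]⇒∣a-c m a b c d m∣lhs =
  ∣m+n∣n⇒∣m (subst (+ m ∣_) (split a b c d (+ m)) m∣lhs) (∣m⇒∣m*n (b - d) ∣-refl)
  where
  split : ∀ a b c d m → (a + m * b) - (c + m * d) ≡ (a - c) + m * (b - d)
  split = solve-∀

m*m∣[a+m*b]-[a+m*d]⇒∣b-d : ∀ m .{{_ : NonZero m}} a b d →
                           + (m ℕ.* m) ∣ (a + + m * b) - (a + + m * d) → + m ∣ b - d
m*m∣[a+m*b]-[a+m*d]⇒∣b-d m a b d m*m∣lhs =
  *-cancelˡ-∣ (+ m) (subst₂ _∣_ (ℤ.pos-* m m) (factor a b d (+ m)) m*m∣lhs)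
  where
  factor : ∀ a b d m → (a + m * b) - (a + m * d) ≡ m * (b - d)
  factor = solve-∀

Fin-injective⇒surjective : ∀ {n} (f : Fin n → Fin n) → Injective _≡_ _≡_ f → Surjective _≡_ _≡_ f
Fin-injective⇒surjective f f-inj y with Fin.any? (λ x → f x Fin.≟ y)
... | yes (x , fx≡y) = x , λ { refl → fx≡y }
Fin-injective⇒surjective {ℕ.suc n} f f-inj y | no y∉image =
  let i , j , i<j , gi≡gj = Fin.pigeonhole (ℕ.n<1+n n) (λ x → punchOut (fx≢y x))
  in contradiction (f-inj (Fin.punchOut-injective (fx≢y i) (fx≢y j) gi≡gj)) (Fin.<⇒≢ i<j)
  where
  fx≢y : ∀ x → y ≢ f x
  fx≢y x y≡fx = y∉image (x , sym y≡fx)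

↔Fin-injective⇒surjective : ∀ {a} {A : Set a} {n} → Fin n ↔ A → (f : A → Fin n) →
                            Injective _≡_ _≡_ f → Surjective _≡_ _≡_ f
↔Fin-injective⇒surjective e f f-inj y
  with x , fx≡y ← Fin-injective⇒surjective (f ∘ Inverse.to e)
                                            (Injection.injective (↔⇒↣ e) ∘ f-inj) y
  = Inverse.to e x , λ { refl → fx≡y refl }

module _ (p : ℕ) .{{_ : NonZero p}} (α : Fin p) where

  ι : Fin p → ℤ
  ι i = + toℕ i

  gap : Fin p × Fin p → ℤ
  gap (i , j) = ι j - ι i

  tilt : Fin p × Fin p → ℤ
  tilt (i , j) = + 2 * ι i - ι j

  residue : Fin p × Fin p → ℕ
  residue x = (+ toℕ α * gap x) %ℕ p

  -- Fhat p α x unfolds to reduce (p ℕ.* p) (lift x).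
  lift : Fin p × Fin p → ℤ
  lift x = + residue x + + p * tilt x

  -- (i, j) ↦ (2i - j, j - i) has determinant 1: i = tilt + gap and j = i + gap.
  tilt-gap-∣⇒≡ : ∀ {x y} → + p ∣ tilt x - tilt y → + p ∣ gap x - gap y → x ≡ y
  tilt-gap-∣⇒≡ {i , j} {i′ , j′} p∣tilt p∣gap = cong₂ _,_ (Fin-∣⇒≡ p∣i-i′) (Fin-∣⇒≡ p∣j-j′)
    where
    i-from : ∀ i j i′ j′ → ((+ 2 * i - j) - (+ 2 * i′ - j′)) + ((j - i) - (j′ - i′)) ≡ i - i′
    i-from = solve-∀
    j-from : ∀ i j i′ j′ → ((j - i) - (j′ - i′)) + (i - i′) ≡ j - j′
    j-from = solve-∀
    p∣i-i′ : + p ∣ ι i - ι i′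
    p∣i-i′ = subst (+ p ∣_) (i-from (ι i) (ι j) (ι i′) (ι j′)) (∣m∣n⇒∣m+n p∣tilt p∣gap)
    p∣j-j′ : + p ∣ ι j - ι j′
    p∣j-j′ = subst (+ p ∣_) (j-from (ι i) (ι j) (ι i′) (ι j′)) (∣m∣n⇒∣m+n p∣gap p∣i-i′)

  Fhat-injective : Prime p → ¬ (toℕ α ≡ 0) → Injective _≡_ _≡_ (Fhat p α)
  Fhat-injective p-prime α≢0 {x} {y} Fx≡Fy = tilt-gap-∣⇒≡ p∣tilt p∣gap
    where
    p²∣lift : + (p ℕ.* p) ∣ lift x - lift y
    p²∣lift = reduce≡⇒∣ (p ℕ.* p) {{ℕ.m*n≢0 p p}} (lift x) (lift y) Fx≡Fy
    residue≡ : residue x ≡ residue y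
    residue≡ = ∣-<⇒≡ (n%ℕd<d (ι α * gap x) p) (n%ℕd<d (ι α * gap y) p)
      (∣[a+m*b]-[c+m*d]⇒∣a-c p (+ residue x) (tilt x) (+ residue y) (tilt y)
                               (∣-trans (n∣n*n p) p²∣lift))
    p∣tilt : + p ∣ tilt x - tilt y
    p∣tilt = m*m∣[a+m*b]-[a+m*d]⇒∣b-d p (+ residue x) (tilt x) (tilt y)
      (subst (λ r → + (p ℕ.* p) ∣ lift x - (+ r + + p * tilt y)) (sym residue≡) p²∣lift)
    factor : ∀ a e e′ → a * e - a * e′ ≡ a * (e - e′)
    factor = solve-∀
    p∣gap : + p ∣ gap x - gap y
    p∣gap = prime∣n*i⇒∣i p-prime {{ℕ.≢-nonZero α≢0}} (Fin.toℕ<n α)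
      (subst (+ p ∣_) (factor (ι α) (gap x) (gap y)) (%ℕ≡⇒∣ p (ι α * gap x) (ι α * gap y) residue≡))

  Fhat-surjective : Prime p → ¬ (toℕ α ≡ 0) → Surjective _≡_ _≡_ (Fhat p α)
  Fhat-surjective p-prime α≢0 =
    ↔Fin-injective⇒surjective (Fin.*↔× {p} {p}) (Fhat p α) (Fhat-injective p-prime α≢0)

lemma5 : (p : ℕ) .{{_ : NonZero p}} → Prime p → (α : Fin p) → ¬ (toℕ α ≡ 0) → Bijective {A = Fin p × Fin p} _≡_ _≡_ (Fhat p α)
lemma5 p p-prime α α≢0 = Fhat-injective p α p-prime α≢0 , Fhat-surjective p α p-prime α≢0
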